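{- For every integer $m\ge1$, every term of $X\cdot P^m\cdot X\in B^{\otimes(m+1)}$ contains the letter $Z$ at least once.
   Context: Let $\mathcal M=\mathbb Z\langle y,n\rangle/(yn=ny=n,\ n^2=0,\ y^2=y)$. In the ring $\mathcal M\otimes\mathcal M$ (tensor over $\mathbb Z$, with $(a\otimes b)(c\otimes d)=ac\otimes bd$) put $X=y\otimes n+n\otimes y$, $Y=y\otimes y$, $Z=n\otimes n$, and let $B$ be the $\mathbb Z$-span of $X,Y,Z$: a commutative subring, free abelian with basis $X,Y,Z$, with $X^2=2Z$, $Y^2=Y$, $Z^2=0$, $XY=YX=X$, $XZ=ZX=0$, $YZ=ZY=Z$. For $r\ge1$, $B^{\otimes r}$ is free abelian with basis the words $w_1\otimes\cdots\otimes w_r$, $w_i\in\{X,Y,Z\}$; writing $u\in B^{\otimes r}$ uniquely as $\sum_w c_w w$, a term of $u$ is a word $w$ with $c_w\ne0$, and $c_w$ is its coefficient. The chaining product $B^{\otimes r}\times B^{\otimes s}\to B^{\otimes(r+s-1)}$ is the bilinear (associative) map $(a_1\otimes\cdots\otimes a_r)\cdot(b_1\otimes\cdots\otimes b_s)=a_1\otimes\cdots\otimes a_{r-1}\otimes(a_rb_1)\otimes b_2\otimes\cdots\otimes b_s$. Elements of $B$ are regarded as elements of $B^{\otimes1}$. Let $P=X\otimes Y+Y\otimes X\in B^{\otimes2}$ and let $P^m\in B^{\otimes(m+1)}$ be its $m$-fold chaining product. -}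

module Defs where

open import Data.Nat using (ℕ; zero; suc; _+_)
open import Data.Integer using (ℤ; +_; _*_) renaming (_+_ to _+ℤ_)
open import Data.List using (List; []; _∷_; concatMap; map)
open import Data.Empty using (⊥)
open import Data.Product using (_×_; _,_)
open import Data.Vec using (Vec; []; _∷_; _++_; init; last)
open import Relation.Nullary using (yes; no; Dec)
open import Relation.Binary.PropositionalEquality using (_≡_; refl)
open import Relation.Binary.Definitions using (DecidableEquality)
import Data.Vec.Properties as VecP

data Letter : Set where
  X Y Z : Letter

_≟L_ : DecidableEquality Letter
X ≟L X = yes refl
X ≟L Y = no (λ ())
X ≟L Z = no (λ ())
Y ≟L X = no (λ ())
Y ≟L Y = yes refl
Y ≟L Z = no (λ ())
Z ≟L X = no (λ ())
Z ≟L Y = no (λ ())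
Z ≟L Z = yes refl

mulL : Letter → Letter → List (ℤ × Letter)
mulL X X = (+ 2 , Z) ∷ []
mulL X Y = (+ 1 , X) ∷ []
mulL X Z = []
mulL Y X = (+ 1 , X) ∷ []
mulL Y Y = (+ 1 , Y) ∷ []
mulL Y Z = (+ 1 , Z) ∷ []
mulL Z X = []
mulL Z Y = (+ 1 , Z) ∷ []
mulL Z Z = []

Word : ℕ → Set
Word r = Vec Letter r

-- An element of B^{⊗r}, given as a formal (not necessarily reduced) ℤ-linear
-- combination of words; its actual value is determined by `coeff`.
Tensor : ℕ → Set
Tensor r = List (ℤ × Word r)

coeff : ∀ {r} → Tensor r → Word r → ℤ
coeff [] w = + 0
coeff ((c , v) ∷ u) w with VecP.≡-dec _≟L_ v w
... | yes _ = c +ℤ coeff u w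
... | no _ = coeff u w

IsTerm : ∀ {r} → Tensor r → Word r → Set
IsTerm u w = coeff u w ≡ + 0 → ⊥

chainW : ∀ {r s} → Word (suc r) → Word (suc s) → Tensor (r + suc s)
chainW a (b ∷ bs) = map (λ { (e , l) → (e , init a ++ (l ∷ bs)) }) (mulL (last a) b)

chain : ∀ {r s} → Tensor (suc r) → Tensor (suc s) → Tensor (r + suc s)
chain u v = concatMap (λ { (c , a) → concatMap (λ { (d , b) →
              map (λ { (e , w) → (c * d * e , w) }) (chainW a b) }) v }) u

Xt : Tensor 1
Xt = (+ 1 , X ∷ []) ∷ []

P : Tensor 2
P = (+ 1 , X ∷ Y ∷ []) ∷ (+ 1 , Y ∷ X ∷ []) ∷ []

-- PPow k = P^(k+1) ∈ B^{⊗(k+2)}, the (k+1)-fold chaining product of P.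
PPow : (k : ℕ) → Tensor (suc (suc k))
PPow zero = P
PPow (suc k) = chain P (PPow k)

{-# OPTIONS --safe #-}
-- The coefficients play no role: every word of the unreduced expansion of X·P^m·X already
-- contains Z. As Y is a unit for X and Y, chaining X⊗Y onto a word just prepends X, while chaining
-- Y⊗X either creates X² = 2Z or trades the leading Y for X and prepends Y; so the Z-free words
-- of P^m have at most one Y. Multiplying by X on the right turns a final Y into X and a final X
-- into 2Z, so the Z-free words of P^m·X contain no Y, hence begin with X, which the left factor X
-- turns into 2Z.
module Submission where

open import Defs
open import Data.Nat using (ℕ; zero; suc; _+_; _≤_; z≤n; s≤s; s≤s⁻¹)
open import Data.Nat.Properties using (+-identityʳ; module ≤-Reasoning)
open import Data.Product using (_,_; proj₂)
open import Data.Sum using (_⊎_; inj₁; inj₂)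
open import Data.Empty using (⊥-elim)
open import Data.List using ([]; _∷_)
open import Data.List.Relation.Unary.All using (All; []; _∷_)
import Data.List.Relation.Unary.All as All
open import Data.List.Relation.Unary.All.Properties using (map⁺; concat⁺)
open import Data.Vec using ([]; _∷_; _++_; _∷ʳ_; init; last; initLast)
open import Data.Vec.Relation.Unary.Any using (Any; here; there)
open import Data.Vec.Relation.Unary.Any.Properties using (++⁺ˡ; ++⁺ʳ)
open import Relation.Nullary using (yes; no)
open import Relation.Binary.PropositionalEquality using (_≡_; refl; subst; cong)
import Data.Vec.Properties as VecP

AllWords : ∀ {n} → (Word n → Set) → Tensor n → Set
AllWords R u = All (λ p → R (proj₂ p)) u

AllWords⇒term : ∀ {n} {R : Word n → Set} {u : Tensor n} {w : Word n} →
  AllWords R u → IsTerm u w → R w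
AllWords⇒term {u = []} [] term = ⊥-elim (term refl)
AllWords⇒term {u = (c , v) ∷ u} {w} (rv ∷ ru) term with VecP.≡-dec _≟L_ v w
... | yes refl = rv
... | no _ = AllWords⇒term ru term

chain⁺ : ∀ {r s} {R : Word (suc r) → Set} {S : Word (suc s) → Set} {T : Word (r + suc s) → Set}
  {u : Tensor (suc r)} {v : Tensor (suc s)} →
  (∀ {a b} → R a → S b → AllWords T (chainW a b)) →
  AllWords R u → AllWords S v → AllWords T (chain u v)
chain⁺ step ru sv =
  concat⁺ (map⁺ (All.map (λ ra → concat⁺ (map⁺ (All.map (λ sb → map⁺ (step ra sb)) sv))) ru))

HasZ : ∀ {n} → Word n → Set
HasZ = Any (_≡ Z)

countY : ∀ {n} → Word n → ℕ
countY [] = 0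
countY (X ∷ w) = countY w
countY (Y ∷ w) = suc (countY w)
countY (Z ∷ w) = countY w

countY-++ : ∀ {m n} (xs : Word m) (ys : Word n) → countY (xs ++ ys) ≡ countY xs + countY ys
countY-++ [] ys = refl
countY-++ (X ∷ xs) ys = countY-++ xs ys
countY-++ (Y ∷ xs) ys = cong suc (countY-++ xs ys)
countY-++ (Z ∷ xs) ys = countY-++ xs ys

countY-∷ʳY : ∀ {n} (xs : Word n) → countY (xs ∷ʳ Y) ≡ suc (countY xs)
countY-∷ʳY [] = refl
countY-∷ʳY (X ∷ xs) = countY-∷ʳY xs
countY-∷ʳY (Y ∷ xs) = cong suc (countY-∷ʳY xs)
countY-∷ʳY (Z ∷ xs) = countY-∷ʳY xs

HasZ-∷ʳY⁻ : ∀ {n} (xs : Word n) → HasZ (xs ∷ʳ Y) → HasZ xs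
HasZ-∷ʳY⁻ [] (here ())
HasZ-∷ʳY⁻ [] (there ())
HasZ-∷ʳY⁻ (x ∷ xs) (here x≡Z) = here x≡Z
HasZ-∷ʳY⁻ (x ∷ xs) (there z) = there (HasZ-∷ʳY⁻ xs z)

HasZ⊎countY≤ : ℕ → ∀ {n} → Word n → Set
HasZ⊎countY≤ k w = HasZ w ⊎ countY w ≤ k

XY·-HasZ⊎countY≤1 : ∀ {s} (b : Word (suc s)) →
  HasZ⊎countY≤ 1 b → AllWords (HasZ⊎countY≤ 1) (chainW (X ∷ Y ∷ []) b)
XY·-HasZ⊎countY≤1 (X ∷ bs) (inj₁ z) = inj₁ (there z) ∷ []
XY·-HasZ⊎countY≤1 (X ∷ bs) (inj₂ c) = inj₂ c ∷ []
XY·-HasZ⊎countY≤1 (Y ∷ bs) (inj₁ z) = inj₁ (there z) ∷ []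
XY·-HasZ⊎countY≤1 (Y ∷ bs) (inj₂ c) = inj₂ c ∷ []
XY·-HasZ⊎countY≤1 (Z ∷ bs) _ = inj₁ (there (here refl)) ∷ []

YX·-HasZ⊎countY≤1 : ∀ {s} (b : Word (suc s)) →
  HasZ⊎countY≤ 1 b → AllWords (HasZ⊎countY≤ 1) (chainW (Y ∷ X ∷ []) b)
YX·-HasZ⊎countY≤1 (X ∷ bs) _ = inj₁ (there (here refl)) ∷ []
YX·-HasZ⊎countY≤1 (Y ∷ bs) (inj₁ (there z)) = inj₁ (there (there z)) ∷ []
YX·-HasZ⊎countY≤1 (Y ∷ bs) (inj₂ c) = inj₂ c ∷ []
YX·-HasZ⊎countY≤1 (Z ∷ bs) _ = []

P·-HasZ⊎countY≤1 : ∀ {s} {v : Tensor (suc s)} →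
  AllWords (HasZ⊎countY≤ 1) v → AllWords (HasZ⊎countY≤ 1) (chain P v)
P·-HasZ⊎countY≤1 = chain⁺ {u = P} step (inj₁ refl ∷ inj₂ refl ∷ [])
  where
  step : ∀ {a b} → a ≡ X ∷ Y ∷ [] ⊎ a ≡ Y ∷ X ∷ [] → HasZ⊎countY≤ 1 b →
    AllWords (HasZ⊎countY≤ 1) (chainW a b)
  step {b = b} (inj₁ refl) = XY·-HasZ⊎countY≤1 b
  step {b = b} (inj₂ refl) = YX·-HasZ⊎countY≤1 b

PPow-HasZ⊎countY≤1 : ∀ k → AllWords (HasZ⊎countY≤ 1) (PPow k)
PPow-HasZ⊎countY≤1 zero = inj₂ (s≤s z≤n) ∷ inj₂ (s≤s z≤n) ∷ []
PPow-HasZ⊎countY≤1 (suc k) = P·-HasZ⊎countY≤1 (PPow-HasZ⊎countY≤1 k)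

∷ʳ·X-HasZ⊎countY≤0 : ∀ {n} (ys : Word n) (y : Letter) → HasZ⊎countY≤ 1 (ys ∷ʳ y) →
  All (λ p → HasZ⊎countY≤ 0 (ys ++ proj₂ p ∷ [])) (mulL y X)
∷ʳ·X-HasZ⊎countY≤0 ys X _ = inj₁ (++⁺ʳ ys (here refl)) ∷ []
∷ʳ·X-HasZ⊎countY≤0 ys Y (inj₁ z) = inj₁ (++⁺ˡ (HasZ-∷ʳY⁻ ys z)) ∷ []
∷ʳ·X-HasZ⊎countY≤0 ys Y (inj₂ c) = inj₂ noY ∷ []
  where
  noY : countY (ys ++ X ∷ []) ≤ 0
  noY = begin
    countY (ys ++ X ∷ []) ≡⟨ countY-++ ys (X ∷ []) ⟩
    countY ys + 0         ≡⟨ +-identityʳ (countY ys) ⟩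
    countY ys             ≤⟨ s≤s⁻¹ (subst (_≤ 1) (countY-∷ʳY ys) c) ⟩
    0                     ∎
    where open ≤-Reasoning
∷ʳ·X-HasZ⊎countY≤0 ys Z _ = []

·X-HasZ⊎countY≤0 : ∀ {r} (a : Word (suc r)) →
  HasZ⊎countY≤ 1 a → AllWords (HasZ⊎countY≤ 0) (chainW a (X ∷ []))
·X-HasZ⊎countY≤0 a h =
  map⁺ (∷ʳ·X-HasZ⊎countY≤0 (init a) (last a) (subst (HasZ⊎countY≤ 1) a≡init∷ʳlast h))
  where
  a≡init∷ʳlast : a ≡ init a ∷ʳ last a
  a≡init∷ʳlast = proj₂ (proj₂ (initLast a))

·Xt-HasZ⊎countY≤0 : ∀ {r} {u : Tensor (suc r)} →
  AllWords (HasZ⊎countY≤ 1) u → AllWords (HasZ⊎countY≤ 0) (chain u Xt)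
·Xt-HasZ⊎countY≤0 words =
  chain⁺ {S = _≡ X ∷ []} {v = Xt} (λ { {a} h refl → ·X-HasZ⊎countY≤0 a h }) words (refl ∷ [])

X·-HasZ : ∀ {s} (b : Word (suc s)) → HasZ⊎countY≤ 0 b → AllWords HasZ (chainW (X ∷ []) b)
X·-HasZ (X ∷ bs) _ = here refl ∷ []
X·-HasZ (Y ∷ bs) (inj₁ (there z)) = there z ∷ []
X·-HasZ (Z ∷ bs) _ = []

Xt·-HasZ : ∀ {s} {v : Tensor (suc s)} →
  AllWords (HasZ⊎countY≤ 0) v → AllWords HasZ (chain Xt v)
Xt·-HasZ = chain⁺ {R = _≡ X ∷ []} {u = Xt} (λ { {b = b} refl → X·-HasZ b }) (refl ∷ [])

lemma4p2 : (k : ℕ) → (w : Word (suc k + 1)) →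
    IsTerm (chain Xt (chain (PPow k) Xt)) w → Any (_≡ Z) w
lemma4p2 k w = AllWords⇒term (Xt·-HasZ (·Xt-HasZ⊎countY≤0 (PPow-HasZ⊎countY≤1 k)))
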